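{- Let $(A,\dagger)$ be a finite involutory alphabet and $L\subseteq A^{+}$. The syntactic $\star$-semigroup of $L$ divides every finite involution semigroup that recognises $L$; that is, if $(T,\star)$ recognises $L$, then the syntactic $\star$-semigroup of $L$ is the image of a sub-$\star$-semigroup of $(T,\star)$ under a surjective morphism of involution semigroups.
   Context: $(A,\dagger)$: finite set with bijection $\dagger$, $(a^\dagger)^\dagger=a$, extended to words by $(a_1\cdots a_n)^\dagger=a_n^\dagger\cdots a_1^\dagger$; $L^\dagger=\{w^\dagger: w\in L\}$. Involution semigroup $(S,\star)$: $(a^\star)^\star=a$, $(ab)^\star=b^\star a^\star$; morphisms of involution semigroups commute with involutions; a sub-$\star$-semigroup is closed under product and involution. $(T,\star)$ recognises $L$ if there are a morphism of involution semigroups $h:(A^{+},\dagger)\to(T,\star)$ and $P\subseteq T$ with $L=h^{ -1}(P)$. Syntactic congruence: $x\sim_L y$ iff $\forall u,v\in A^{*}$, $uxv\in L\Leftrightarrow uyv\in L$. Syntactic $\star$-congruence: $x\approx_L y$ iff $x\sim_L y$ and $x\sim_{L^\dagger}y$; the syntactic $\star$-semigroup is $A^{+}/\approx_L$ with involution $[\![w]\!]\mapsto[\![w^\dagger]\!]$. -}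

module Defs where

open import Level using (Level; 0ℓ)
open import Data.Nat using (ℕ)
open import Data.Fin using (Fin)
open import Data.Bool using (Bool; true) renaming (T to True)
open import Data.List.NonEmpty using (List⁺; _⁺++⁺_; reverse; map)
open import Data.List using (List; _++_)
open import Data.List.NonEmpty using (toList; _⁺++_; _++⁺_)
open import Data.Product using (Σ; ∃; _×_; _,_)
open import Function.Bundles using (_⇔_; _↔_)
open import Relation.Binary.PropositionalEquality using (_≡_)

record InvAlphabet : Set where
  field
    size    : ℕ
    dag     : Fin size → Fin size
    dag-inv : ∀ a → dag (dag a) ≡ a

  Letter : Set
  Letter = Fin size

  Word : Set
  Word = List⁺ Letter

  dagW : Word → Word
  dagW w = reverse (map dag w)

  Ctx : Set
  Ctx = List Letter


open InvAlphabet public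

Language : InvAlphabet → Set₁
Language 𝔄 = Word 𝔄 → Set

dagL : (𝔄 : InvAlphabet) → Language 𝔄 → Language 𝔄
dagL 𝔄 L w = ∃ λ v → (L v × dagW 𝔄 v ≡ w)

wrap : (𝔄 : InvAlphabet) → Ctx 𝔄 → Word 𝔄 → Ctx 𝔄 → Word 𝔄
wrap 𝔄 u x v = u ++⁺ (x ⁺++ v)

Synt : (𝔄 : InvAlphabet) → Language 𝔄 → Word 𝔄 → Word 𝔄 → Set
Synt 𝔄 L x y = ∀ (u v : Ctx 𝔄) → L (wrap 𝔄 u x v) ⇔ L (wrap 𝔄 u y v)

-- x ≈_L y  iff  x ∼_L y and x ∼_{L†} y.
-- The syntactic ⋆-semigroup A⁺/≈_L is represented as the setoid
-- (Word 𝔄, SyntStar 𝔄 L) with product _⁺++⁺_ and involution dagW 𝔄.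
SyntStar : (𝔄 : InvAlphabet) → Language 𝔄 → Word 𝔄 → Word 𝔄 → Set
SyntStar 𝔄 L x y = Synt 𝔄 L x y × Synt 𝔄 (dagL 𝔄 L) x y

record FinInvSemigroup : Set₁ where
  field
    Carrier : Set
    _∙_     : Carrier → Carrier → Carrier
    _⋆      : Carrier → Carrier
    assoc   : ∀ x y z → (x ∙ y) ∙ z ≡ x ∙ (y ∙ z)
    ⋆-inv   : ∀ x → (x ⋆) ⋆ ≡ x
    ⋆-anti  : ∀ x y → (x ∙ y) ⋆ ≡ (y ⋆) ∙ (x ⋆)
    card    : ℕ
    finite  : Fin card ↔ Carrier

record Recognises (𝔄 : InvAlphabet) (L : Language 𝔄) (S : FinInvSemigroup) : Set₁ where
  open FinInvSemigroup S
  field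
    h       : Word 𝔄 → Carrier
    h-hom   : ∀ x y → h (x ⁺++⁺ y) ≡ h x ∙ h y
    h-inv   : ∀ x → h (dagW 𝔄 x) ≡ (h x) ⋆
    P       : Carrier → Set
    L≡h⁻¹P  : ∀ w → L w ⇔ P (h w)

-- The syntactic ⋆-semigroup divides T: there is a sub-⋆-semigroup U of T
-- (a subset, closed under ∙ and ⋆) and a surjective morphism of
-- involution semigroups φ : U → A⁺/≈_L (maps into the quotient are
-- represented as maps into Word 𝔄, with equations up to ≈_L).
record Divides (𝔄 : InvAlphabet) (L : Language 𝔄) (S : FinInvSemigroup) : Set₁ where
  open FinInvSemigroup S
  field
    U       : Carrier → Set
    U-∙     : ∀ {s t} → U s → U t → U (s ∙ t)
    U-⋆     : ∀ {s} → U s → U (s ⋆)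
    φ       : (s : Carrier) → U s → Word 𝔄
    -- φ depends only on the element of U, not on the membership proof
    φ-irr   : ∀ {s} (p q : U s) → SyntStar 𝔄 L (φ s p) (φ s q)
    φ-hom   : ∀ {s t} (p : U s) (q : U t) →
              SyntStar 𝔄 L (φ (s ∙ t) (U-∙ p q)) (φ s p ⁺++⁺ φ t q)
    φ-inv   : ∀ {s} (p : U s) →
              SyntStar 𝔄 L (φ (s ⋆) (U-⋆ p)) (dagW 𝔄 (φ s p))
    φ-surj  : ∀ w → Σ Carrier λ s → Σ (U s) λ p → SyntStar 𝔄 L (φ s p) w

{-# OPTIONS --safe #-}
module Submission where

-- The image U = h(A⁺) of the recognising morphism is a sub-⋆-semigroup of T,
-- and sending s ∈ U to any word w with h w = s is a surjective morphism onto
-- A⁺/≈_L, provided h x = h y implies x ≈_L y. That holds because the kernel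
-- of h is compatible with contexts u ─ v, while L = h⁻¹(P) and, since h
-- commutes with the involutions, L† = h⁻¹(P ∘ ⋆): both L and L† are unions
-- of kernel classes.

open import Defs
open import Data.Nat using (suc)
open import Data.List as List using (List; []; _∷_)
open import Data.List.NonEmpty as List⁺ using (List⁺; _∷_; _∷⁺_; _⁺++⁺_; _⁺++_; _++⁺_; toList)
open import Data.List.NonEmpty.Properties using (∷→∷⁺)
import Data.List.Properties as List
import Data.Vec as Vec
import Data.Vec.Properties as Vec
open import Data.Product using (Σ; _,_; proj₁)
open import Function.Bundles using (_⇔_; mk⇔)
open import Function.Construct.Composition using (_⇔-∘_)
open import Function.Construct.Symmetry using (⇔-sym)
open import Relation.Binary.PropositionalEquality

private
  variable
    A C : Set

toList-injective : {xs ys : List⁺ A} → toList xs ≡ toList ys → xs ≡ ys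
toList-injective {xs = _ ∷ _} {ys = _ ∷ _} = ∷→∷⁺

toList-reverse : (xs : List⁺ A) → toList (List⁺.reverse xs) ≡ List.reverse (toList xs)
toList-reverse (x ∷ xs) = begin
  toList (List⁺.fromVec (Vec.reverse (x Vec.∷ Vec.fromList xs)))
    ≡⟨ toList-fromVec (Vec.reverse (x Vec.∷ Vec.fromList xs)) ⟩
  Vec.toList (Vec.reverse (x Vec.∷ Vec.fromList xs))
    ≡⟨ Vec.toList-reverse (x Vec.∷ Vec.fromList xs) ⟩
  List.reverse (x ∷ Vec.toList (Vec.fromList xs))
    ≡⟨ cong (λ ys → List.reverse (x ∷ ys)) (Vec.toList∘fromList xs) ⟩
  List.reverse (x ∷ xs) ∎
  where
  open ≡-Reasoning
  toList-fromVec : ∀ {n} (v : Vec.Vec A (suc n)) → toList (List⁺.fromVec v) ≡ Vec.toList v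
  toList-fromVec (_ Vec.∷ _) = refl

reverse-map-involutive : {f : A → A} → (∀ a → f (f a) ≡ a) →
                         ∀ xs → List.reverse (List.map f (List.reverse (List.map f xs))) ≡ xs
reverse-map-involutive {f = f} f-inv xs = begin
  List.reverse (List.map f (List.reverse (List.map f xs)))
    ≡⟨ cong List.reverse (List.reverse-map f (List.map f xs)) ⟩
  List.reverse (List.reverse (List.map f (List.map f xs)))
    ≡⟨ List.reverse-involutive _ ⟩
  List.map f (List.map f xs)
    ≡⟨ List.map-∘ xs ⟨
  List.map (λ a → f (f a)) xs
    ≡⟨ List.map-cong f-inv xs ⟩
  List.map (λ a → a) xs
    ≡⟨ List.map-id xs ⟩
  xs ∎
  where open ≡-Reasoning

⁺++-identityʳ : (xs : List⁺ A) → xs ⁺++ [] ≡ xs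
⁺++-identityʳ (x ∷ xs) = cong (x ∷_) (List.++-identityʳ xs)

∷⁺-as-⁺++⁺ : ∀ (a : A) ys → a ∷⁺ ys ≡ (a ∷ []) ⁺++⁺ ys
∷⁺-as-⁺++⁺ a (_ ∷ _) = refl

module KernelCongruence (_∙_ : C → C → C) (h : List⁺ A → C)
                        (h-hom : ∀ xs ys → h (xs ⁺++⁺ ys) ≡ h xs ∙ h ys) where

  ⁺++-congʳ : ∀ {xs ys} → h xs ≡ h ys → ∀ zs → h (xs ⁺++ zs) ≡ h (ys ⁺++ zs)
  ⁺++-congʳ {xs} {ys} e [] = begin
    h (xs ⁺++ []) ≡⟨ cong h (⁺++-identityʳ xs) ⟩
    h xs          ≡⟨ e ⟩
    h ys          ≡⟨ cong h (⁺++-identityʳ ys) ⟨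
    h (ys ⁺++ []) ∎
    where open ≡-Reasoning
  ⁺++-congʳ {xs} {ys} e (z ∷ zs) = begin
    h (xs ⁺++ (z ∷ zs))    ≡⟨ ⁺++-hom xs ⟩
    h xs ∙ h (z ∷ zs)      ≡⟨ cong (_∙ h (z ∷ zs)) e ⟩
    h ys ∙ h (z ∷ zs)      ≡⟨ ⁺++-hom ys ⟨
    h (ys ⁺++ (z ∷ zs))    ∎
    where
    open ≡-Reasoning
    ⁺++-hom : ∀ ws → h (ws ⁺++ (z ∷ zs)) ≡ h ws ∙ h (z ∷ zs)
    ⁺++-hom (_ ∷ _) = h-hom _ (z ∷ zs)

  ++⁺-congˡ : ∀ {xs ys} → h xs ≡ h ys → ∀ zs → h (zs ++⁺ xs) ≡ h (zs ++⁺ ys)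
  ++⁺-congˡ e [] = e
  ++⁺-congˡ {xs} {ys} e (z ∷ zs) = begin
    h (z ∷⁺ (zs ++⁺ xs))             ≡⟨ cong h (∷⁺-as-⁺++⁺ z (zs ++⁺ xs)) ⟩
    h ((z ∷ []) ⁺++⁺ (zs ++⁺ xs))     ≡⟨ h-hom _ _ ⟩
    h (z ∷ []) ∙ h (zs ++⁺ xs)        ≡⟨ cong (h (z ∷ []) ∙_) (++⁺-congˡ e zs) ⟩
    h (z ∷ []) ∙ h (zs ++⁺ ys)        ≡⟨ h-hom _ _ ⟨
    h ((z ∷ []) ⁺++⁺ (zs ++⁺ ys))     ≡⟨ cong h (∷⁺-as-⁺++⁺ z (zs ++⁺ ys)) ⟨
    h (z ∷⁺ (zs ++⁺ ys))             ∎
    where open ≡-Reasoning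

module _ (𝔄 : InvAlphabet) where

  dagW-involutive : ∀ w → dagW 𝔄 (dagW 𝔄 w) ≡ w
  dagW-involutive w = toList-injective (begin
    toList (dagW 𝔄 (dagW 𝔄 w))
      ≡⟨ toList-dagW (dagW 𝔄 w) ⟩
    List.reverse (List.map (dag 𝔄) (toList (dagW 𝔄 w)))
      ≡⟨ cong (λ xs → List.reverse (List.map (dag 𝔄) xs)) (toList-dagW w) ⟩
    List.reverse (List.map (dag 𝔄) (List.reverse (List.map (dag 𝔄) (toList w))))
      ≡⟨ reverse-map-involutive (dag-inv 𝔄) (toList w) ⟩
    toList w ∎)
    where
    open ≡-Reasoning
    toList-dagW : ∀ v → toList (dagW 𝔄 v) ≡ List.reverse (List.map (dag 𝔄) (toList v))
    toList-dagW v@(_ ∷ _) = toList-reverse (List⁺.map (dag 𝔄) v)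

  dagL-⇔ : ∀ L w → dagL 𝔄 L w ⇔ L (dagW 𝔄 w)
  dagL-⇔ L w = mk⇔ (λ { (v , v∈L , refl) → subst L (sym (dagW-involutive v)) v∈L })
                   (λ w†∈L → dagW 𝔄 w , w†∈L , dagW-involutive w)

  module _ {L : Language 𝔄} {S : FinInvSemigroup} (R : Recognises 𝔄 L S) where
    open FinInvSemigroup S
    open Recognises R
    open KernelCongruence _∙_ h h-hom

    ker⊆Synt : ∀ {x y} → h x ≡ h y → Synt 𝔄 L x y
    ker⊆Synt e u v = ⇔-sym (L≡h⁻¹P (wrap 𝔄 u _ v)) ⇔-∘
      subst (λ t → L (wrap 𝔄 u _ v) ⇔ P t) (++⁺-congˡ (⁺++-congʳ e v) u) (L≡h⁻¹P (wrap 𝔄 u _ v))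

    recognises-dagL : Recognises 𝔄 (dagL 𝔄 L) S
    recognises-dagL = record
      { h      = h
      ; h-hom  = h-hom
      ; h-inv  = h-inv
      ; P      = λ t → P (t ⋆)
      ; L≡h⁻¹P = λ w → subst (λ t → dagL 𝔄 L w ⇔ P t) (h-inv w) (L≡h⁻¹P (dagW 𝔄 w) ⇔-∘ dagL-⇔ L w)
      }

  module _ {L : Language 𝔄} {S : FinInvSemigroup} (R : Recognises 𝔄 L S) where
    open FinInvSemigroup S
    open Recognises R

    ker⊆SyntStar : ∀ {x y} → h x ≡ h y → SyntStar 𝔄 L x y
    ker⊆SyntStar e = ker⊆Synt R e , ker⊆Synt (recognises-dagL R) e

    image-divides : Divides 𝔄 L S
    image-divides = record
      { U      = λ s → Σ (Word 𝔄) λ w → h w ≡ s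
      ; U-∙    = λ { (x , refl) (y , refl) → x ⁺++⁺ y , h-hom x y }
      ; U-⋆    = λ { (x , refl) → dagW 𝔄 x , h-inv x }
      ; φ      = λ _ → proj₁
      ; φ-irr  = λ { (_ , hx≡s) (_ , hy≡s) → ker⊆SyntStar (trans hx≡s (sym hy≡s)) }
      ; φ-hom  = λ { (_ , refl) (_ , refl) → ker⊆SyntStar refl }
      ; φ-inv  = λ { (_ , refl) → ker⊆SyntStar refl }
      ; φ-surj = λ w → h w , (w , refl) , ker⊆SyntStar refl
      }

proposition4 : (𝔄 : InvAlphabet) (L : Language 𝔄) (S : FinInvSemigroup) →
    Recognises 𝔄 L S → Divides 𝔄 L S
proposition4 𝔄 L S R = image-divides 𝔄 R
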